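{- Let $\mu,\nu,\lambda$ be polynomial dominant weights of $GL_n$, let $H\in\mathcal{H}(\mu,\nu,\lambda)$, and let $T_1(H)$, $T_2(H)$ be its derived $t$-arrays. Then $T_1(H)$ satisfies IC(1) if and only if $\varepsilon^{(i)}_j(T_2(H))\le\mu_i-\mu_{i+1}$ for all $1\le j\le i\le n-1$.
   Context: A polynomial dominant weight of $GL_n$ is a sequence of nonnegative integers $(\mu_1,\dots,\mu_n)$ with $\mu_1\ge\dots\ge\mu_n$. A $t$-array is an integer array $T=(t^{(i)}_j)_{1\le j\le i\le n}$. It satisfies IC(1) if $t^{(i+1)}_j\ge t^{(i)}_j$ for all $1\le j\le i\le n-1$. Its exponents are $\varepsilon^{(i)}_j(T)=\sum_{1\le h<j}(t^{(i+1)}_h-2t^{(i)}_h+t^{(i-1)}_h)+(t^{(i+1)}_j-t^{(i)}_j)$ for $1\le j\le i\le n-1$. An $h$-array is an array of nonnegative integers $H=(h_{a,b})_{0\le a\le b\le n}$ with $h_{0,0}=0$; $\mathcal{H}(\mu,\nu,\lambda)$ is the set of $h$-arrays with $h_{0,i}=\mu_1+\dots+\mu_i$, $h_{i,n}=\sum_{j=1}^n\mu_j+\nu_1+\dots+\nu_i$, $h_{i,i}=\lambda_1+\dots+\lambda_i$ for $1\le i\le n$. The derived $t$-arrays $T_1(H)=(x^{(i)}_j)$, $T_2(H)=(y^{(i)}_j)$ are defined, for $0\le a\le b\le n-1$, by $x^{(n-a)}_{b+1-a}=h_{a,b+1}-h_{a,b}$ and $y^{(b+1)}_{a+1}=h_{a+1,b+1}-h_{a,b+1}$.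 -}

module Defs where

open import Data.Nat as ℕ using (ℕ; zero; suc; _∸_)
open import Data.Integer as ℤ using (ℤ; +_; _-_; _*_)
open import Relation.Binary.PropositionalEquality using (_≡_)
open import Data.Product using (_×_)

-- Convention: sequences indexed from 1 are functions ℕ → ℕ; only indices 1..n matter.

psum : (ℕ → ℕ) → ℕ → ℕ
psum f zero = 0
psum f (suc i) = psum f i ℕ.+ f (suc i)

-- polynomial dominant weight of GL_n: μ_1 ≥ μ_2 ≥ ... ≥ μ_n ≥ 0 (nonnegativity automatic in ℕ)
Dominant : ℕ → (ℕ → ℕ) → Set
Dominant n μ = ∀ i → 1 ℕ.≤ i → i ℕ.< n → μ (suc i) ℕ.≤ μ i

-- t-array: t i j = t^{(i)}_j, meaningful for 1 ≤ j ≤ i ≤ n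
TArray : Set
TArray = ℕ → ℕ → ℤ

-- h-array: h a b = h_{a,b}, meaningful for 0 ≤ a ≤ b ≤ n
HArray : Set
HArray = ℕ → ℕ → ℕ

IC1 : ℕ → TArray → Set
IC1 n t = ∀ i j → 1 ℕ.≤ j → j ℕ.≤ i → i ℕ.≤ n ∸ 1 → t i j ℤ.≤ t (suc i) j

zsum : (ℕ → ℤ) → ℕ → ℤ
zsum f zero = + 0
zsum f (suc k) = zsum f k ℤ.+ f (suc k)

ε : TArray → ℕ → ℕ → ℤ
ε t i j =
  zsum (λ h → (t (suc i) h - (+ 2) * t i h) ℤ.+ t (i ∸ 1) h) (j ∸ 1)
  ℤ.+ (t (suc i) j - t i j)

InH : ℕ → (ℕ → ℕ) → (ℕ → ℕ) → (ℕ → ℕ) → HArray → Set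
InH n μ ν λ′ h =
  (h 0 0 ≡ 0) ×
  (∀ i → 1 ℕ.≤ i → i ℕ.≤ n →
     (h 0 i ≡ psum μ i) ×
     (h i n ≡ psum μ n ℕ.+ psum ν i) ×
     (h i i ≡ psum λ′ i))

-- T_1(H): x^{(n-a)}_{b+1-a} = h_{a,b+1} - h_{a,b}, i.e. with i = n-a, j = b+1-a:
-- x^{(i)}_j = h_{n-i, n-i+j} - h_{n-i, n-i+j-1}
T₁ : ℕ → HArray → TArray
T₁ n h i j = + h (n ∸ i) ((n ∸ i) ℕ.+ j) - + h (n ∸ i) ((n ∸ i) ℕ.+ j ∸ 1)

-- T_2(H): y^{(b+1)}_{a+1} = h_{a+1,b+1} - h_{a,b+1}, i.e. y^{(i)}_j = h_{j,i} - h_{j-1,i}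
T₂ : HArray → TArray
T₂ h i j = + h j i - + h (j ∸ 1) i

module Submission where

-- Both sides of the equivalence are reformulations of one family of
-- "rhombus inequalities" on the h-array:
--
--   Rhombus(J, I) :  h_{J,I+1} - h_{J,I}  ≤  h_{J-1,I} - h_{J-1,I-1}      (1 ≤ J ≤ I ≤ n-1),
--
-- comparing the increment of row J of H with the diagonally preceding
-- increment of row J-1.
--
-- * Exponent side.  The summand of ε^{(i)}_j(T₂(H)) is a difference of the
--   column second differences δ²_i(x) = h_{x,i+1} - 2h_{x,i} + h_{x,i-1}
--   in consecutive rows, so the sum telescopes; the boundary term δ²_i(0)
--   is μ_{i+1} - μ_i because row 0 of H consists of partial sums of μ.
--   This gives a closed form in which ε^{(i)}_j ≤ μ_i - μ_{i+1} is exactly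
--   Rhombus(j, i).
-- * IC(1) side.  Unfolding T₁, the inequality x^{(i)}_j ≤ x^{(i+1)}_j is
--   literally Rhombus(n-i, n-i+j-1), and (i, j) ↦ (n-i, n-i+j-1) is a
--   bijection of the index triangle {1 ≤ j ≤ i ≤ n-1} onto itself.

open import Defs
open import Data.Nat using (ℕ; suc; _∸_)
open import Data.Integer using (+_; _-_)
open import Function.Bundles using (_⇔_)

open import Data.Nat as ℕ using (zero; z≤n; s≤s)
open import Data.Nat.Properties
  using (m<n⇒0<n∸m; m∸[m∸n]≡n; m+[n∸m]≡n; m∸n+n≡m; +-∸-assoc; +-suc;
         ∸-monoˡ-≤; ∸-monoʳ-≤; m≤m+n; +-monoʳ-≤; <⇒≤; ≤-refl; ≤-<-trans; m≤n⇒m≤1+n)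
open import Data.Integer as ℤ using (ℤ; _+_; _*_)
open import Data.Integer.Properties using (pos-+; +-inverseʳ; i≤j⇒i-j≤0; i-j≤0⇒i≤j)
open import Data.Integer.Tactic.RingSolver using (solve-∀)
open import Data.Product using (Σ; _×_; _,_; proj₁)
open import Function.Bundles using (mk⇔; Equivalence)
open import Function.Base using (id)
import Function.Properties.Equivalence as ⇔
open import Relation.Binary.PropositionalEquality
  using (_≡_; refl; sym; trans; cong; subst; subst₂; module ≡-Reasoning)

zsum-telescope : (f : ℕ → ℤ) (m : ℕ) → zsum (λ k → f k - f (k ∸ 1)) m ≡ f m - f 0
zsum-telescope f zero = sym (+-inverseʳ (f 0))
zsum-telescope f (suc m) = begin
    zsum (λ k → f k - f (k ∸ 1)) m + (f (suc m) - f m)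
  ≡⟨ cong (_+ (f (suc m) - f m)) (zsum-telescope f m) ⟩
    (f m - f 0) + (f (suc m) - f m)
  ≡⟨ chain (f 0) (f m) (f (suc m)) ⟩
    f (suc m) - f 0
  ∎
  where
    open ≡-Reasoning
    chain : ∀ a b c → (b - a) + (c - b) ≡ c - a
    chain = solve-∀

zsum-cong : {f g : ℕ → ℤ} → (∀ k → f k ≡ g k) → ∀ m → zsum f m ≡ zsum g m
zsum-cong f≗g zero = refl
zsum-cong f≗g (suc m) rewrite zsum-cong f≗g m | f≗g (suc m) = refl

psum-second-difference : (f : ℕ → ℕ) (i : ℕ) →
  (+ psum f (suc (suc i)) - + 2 * + psum f (suc i)) + + psum f i ≡ + f (suc (suc i)) - + f (suc i)
psum-second-difference f i
  rewrite pos-+ (psum f i ℕ.+ f (suc i)) (f (suc (suc i))) | pos-+ (psum f i) (f (suc i)) =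
  second (+ psum f i) (+ f (suc i)) (+ f (suc (suc i)))
  where
    second : ∀ s a b → ((s + a + b) - + 2 * (s + a)) + s ≡ b - a
    second = solve-∀

shift-≤⇔ : (d c e : ℤ) → ((d + c) - e ℤ.≤ c) ⇔ (d ℤ.≤ e)
shift-≤⇔ d c e = mk⇔
  (λ le → i-j≤0⇒i≤j (subst (ℤ._≤ + 0) (difference d c e) (i≤j⇒i-j≤0 le)))
  (λ le → i-j≤0⇒i≤j (subst (ℤ._≤ + 0) (sym (difference d c e)) (i≤j⇒i-j≤0 le)))
  where
    difference : ∀ d c e → ((d + c) - e) - c ≡ d - e
    difference = solve-∀

triangle-< : ∀ {i j n} → 1 ℕ.≤ j → j ℕ.≤ i → i ℕ.≤ n ∸ 1 → i ℕ.< n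
triangle-< {n = zero} (s≤s _) (s≤s _) ()
triangle-< {n = suc n} _ _ i≤n = s≤s i≤n

reflect-lower : ∀ a j → 1 ℕ.≤ j → a ℕ.≤ a ℕ.+ j ∸ 1
reflect-lower a (suc j) _ = subst (a ℕ.≤_) (sym (cong (_∸ 1) (+-suc a j))) (m≤m+n a j)

reflect-upper : ∀ {i j n} → j ℕ.≤ i → i ℕ.≤ n → n ∸ i ℕ.+ j ∸ 1 ℕ.≤ n ∸ 1
reflect-upper {i} {j} {n} j≤i i≤n =
  ∸-monoˡ-≤ 1 (subst (n ∸ i ℕ.+ j ℕ.≤_) (m∸n+n≡m i≤n) (+-monoʳ-≤ (n ∸ i) j≤i))

∸-consecutive : ∀ {i n} → i ℕ.< n → Σ ℕ (λ a → (n ∸ i ≡ suc a) × (n ∸ suc i ≡ a))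
∸-consecutive {zero} {suc n} _ = n , refl , refl
∸-consecutive {suc i} {suc n} (s≤s i<n) = ∸-consecutive i<n

Row0 : ℕ → (ℕ → ℕ) → HArray → Set
Row0 n μ h = ∀ k → k ℕ.≤ n → h 0 k ≡ psum μ k

rowStep : HArray → ℕ → ℕ → ℤ
rowStep h J I = + h J (suc I) - + h J I

Rhombus : HArray → ℕ → ℕ → Set
Rhombus h J I = rowStep h J I ℤ.≤ + h (J ∸ 1) I - + h (J ∸ 1) (I ∸ 1)

AllRhombi : ℕ → HArray → Set
AllRhombi n h = ∀ J I → 1 ℕ.≤ J → J ℕ.≤ I → I ℕ.≤ n ∸ 1 → Rhombus h J I

δ² : HArray → ℕ → ℕ → ℤ
δ² h i x = (+ h x (suc i) - + 2 * + h x i) + + h x (i ∸ 1)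

T₂-summand : (h : HArray) (i k : ℕ) →
  (T₂ h (suc i) k - + 2 * T₂ h i k) + T₂ h (i ∸ 1) k ≡ δ² h i k - δ² h i (k ∸ 1)
T₂-summand h i k =
  rearrange (+ h k (suc i)) (+ h k i) (+ h k (i ∸ 1))
            (+ h (k ∸ 1) (suc i)) (+ h (k ∸ 1) i) (+ h (k ∸ 1) (i ∸ 1))
  where
    rearrange : ∀ a b c a′ b′ c′ →
      ((a - a′) - + 2 * (b - b′)) + (c - c′) ≡ ((a - + 2 * b) + c) - ((a′ - + 2 * b′) + c′)
    rearrange = solve-∀

δ²-row0 : ∀ n μ (h : HArray) → Row0 n μ h →
  ∀ i → suc (suc i) ℕ.≤ n → δ² h (suc i) 0 ≡ + μ (suc (suc i)) - + μ (suc i)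
δ²-row0 n μ h row0 i i+2≤n
  rewrite row0 (suc (suc i)) i+2≤n | row0 (suc i) (<⇒≤ i+2≤n) | row0 i (<⇒≤ (<⇒≤ i+2≤n)) =
  psum-second-difference μ i

ε-T₂-closed : ∀ n μ (h : HArray) → Row0 n μ h →
  ∀ i j → suc (suc i) ℕ.≤ n →
  ε (T₂ h) (suc i) (suc j) ≡
    (rowStep h (suc j) (suc i) + (+ μ (suc i) - + μ (suc (suc i)))) - (+ h j (suc i) - + h j i)
ε-T₂-closed n μ h row0 i j i+2≤n = begin
    zsum (λ k → (T₂ h (suc (suc i)) k - + 2 * T₂ h (suc i) k) + T₂ h i k) j + lastStep
  ≡⟨ cong (_+ lastStep) (zsum-cong (T₂-summand h (suc i)) j) ⟩
    zsum (λ k → δ² h (suc i) k - δ² h (suc i) (k ∸ 1)) j + lastStep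
  ≡⟨ cong (_+ lastStep) (zsum-telescope (δ² h (suc i)) j) ⟩
    (δ² h (suc i) j - δ² h (suc i) 0) + lastStep
  ≡⟨ cong (λ b → (δ² h (suc i) j - b) + lastStep) (δ²-row0 n μ h row0 i i+2≤n) ⟩
    (δ² h (suc i) j - (+ μ (suc (suc i)) - + μ (suc i))) + lastStep
  ≡⟨ collect (+ h j (suc (suc i))) (+ h j (suc i)) (+ h j i)
             (+ h (suc j) (suc (suc i))) (+ h (suc j) (suc i)) (+ μ (suc i)) (+ μ (suc (suc i))) ⟩
    (rowStep h (suc j) (suc i) + (+ μ (suc i) - + μ (suc (suc i)))) - (+ h j (suc i) - + h j i)
  ∎
  where
    open ≡-Reasoning
    lastStep : ℤ
    lastStep = T₂ h (suc (suc i)) (suc j) - T₂ h (suc i) (suc j)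
    collect : ∀ a b c A B m m′ →
      (((a - + 2 * b) + c) - (m′ - m)) + ((A - a) - (B - b)) ≡ ((A - B) + (m - m′)) - (b - c)
    collect = solve-∀

ε-bound⇔rhombus : ∀ n μ (h : HArray) → Row0 n μ h →
  ∀ i j → 1 ℕ.≤ j → j ℕ.≤ i → i ℕ.≤ n ∸ 1 →
  (ε (T₂ h) i j ℤ.≤ + μ i - + μ (suc i)) ⇔ Rhombus h j i
ε-bound⇔rhombus n μ h row0 (suc i) (suc j) _ _ i≤n-1
  rewrite ε-T₂-closed n μ h row0 i j (triangle-< (s≤s z≤n) ≤-refl i≤n-1) = shift-≤⇔ _ _ _

IC1-step⇔rhombus : ∀ n (h : HArray) i j → i ℕ.< n → 1 ℕ.≤ j →
  (T₁ n h i j ℤ.≤ T₁ n h (suc i) j) ⇔ Rhombus h (n ∸ i) (n ∸ i ℕ.+ j ∸ 1)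
IC1-step⇔rhombus n h i (suc j) i<n _ with ∸-consecutive i<n
... | a , n∸i≡1+a , n∸1+i≡a rewrite n∸i≡1+a | n∸1+i≡a = mk⇔ id id

-- Since (i, j) ↦ (n-i, n-i+j-1) maps the index triangle onto itself (with inverse
-- (J, I) ↦ (n-J, I-J+1)), IC(1) for T₁(H) is equivalent to all rhombus inequalities.
IC1⇔AllRhombi : ∀ n (h : HArray) → IC1 n (T₁ n h) ⇔ AllRhombi n h
IC1⇔AllRhombi n h = mk⇔ to from
  where
    to : IC1 n (T₁ n h) → AllRhombi n h
    to ic J I 1≤J J≤I I≤n-1 = subst₂ (Rhombus h) n∸i≡J reflected≡I
      (Equivalence.to (IC1-step⇔rhombus n h i j i<n 1≤j) (ic i j 1≤j j≤i i≤n-1))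
      where
        I<n : I ℕ.< n
        I<n = triangle-< 1≤J J≤I I≤n-1
        J≤n : J ℕ.≤ n
        J≤n = <⇒≤ (≤-<-trans J≤I I<n)
        i j : ℕ
        i = n ∸ J
        j = suc I ∸ J
        1≤j : 1 ℕ.≤ j
        1≤j = subst (1 ℕ.≤_) (sym (+-∸-assoc 1 J≤I)) (s≤s z≤n)
        j≤i : j ℕ.≤ i
        j≤i = ∸-monoˡ-≤ J I<n
        i≤n-1 : i ℕ.≤ n ∸ 1
        i≤n-1 = ∸-monoʳ-≤ n 1≤J
        i<n : i ℕ.< n
        i<n = triangle-< 1≤j j≤i i≤n-1
        n∸i≡J : n ∸ i ≡ J
        n∸i≡J = m∸[m∸n]≡n J≤n
        reflected≡I : n ∸ i ℕ.+ j ∸ 1 ≡ I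
        reflected≡I = trans (cong (λ a → a ℕ.+ j ∸ 1) n∸i≡J)
                            (cong (_∸ 1) (m+[n∸m]≡n (m≤n⇒m≤1+n J≤I)))

    from : AllRhombi n h → IC1 n (T₁ n h)
    from rh i j 1≤j j≤i i≤n-1 = Equivalence.from (IC1-step⇔rhombus n h i j i<n 1≤j)
      (rh (n ∸ i) (n ∸ i ℕ.+ j ∸ 1) (m<n⇒0<n∸m i<n) (reflect-lower (n ∸ i) j 1≤j)
          (reflect-upper j≤i (<⇒≤ i<n)))
      where
        i<n : i ℕ.< n
        i<n = triangle-< 1≤j j≤i i≤n-1

ε-bounds⇔AllRhombi : ∀ n μ (h : HArray) → Row0 n μ h →
  (∀ i j → 1 ℕ.≤ j → j ℕ.≤ i → i ℕ.≤ n ∸ 1 → ε (T₂ h) i j ℤ.≤ + μ i - + μ (suc i))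
    ⇔ AllRhombi n h
ε-bounds⇔AllRhombi n μ h row0 = mk⇔
  (λ bound J I 1≤J J≤I I≤n-1 →
     Equivalence.to (ε-bound⇔rhombus n μ h row0 I J 1≤J J≤I I≤n-1) (bound I J 1≤J J≤I I≤n-1))
  (λ rh i j 1≤j j≤i i≤n-1 →
     Equivalence.from (ε-bound⇔rhombus n μ h row0 i j 1≤j j≤i i≤n-1) (rh j i 1≤j j≤i i≤n-1))

proposition3p4 : (n : ℕ) (μ ν λ′ : ℕ → ℕ) →
    Dominant n μ → Dominant n ν → Dominant n λ′ →
    (h : HArray) → InH n μ ν λ′ h →
    IC1 n (T₁ n h) ⇔
      (∀ i j → 1 Data.Nat.≤ j → j Data.Nat.≤ i → i Data.Nat.≤ n ∸ 1 →
        ε (T₂ h) i j Data.Integer.≤ (+ μ i - + μ (suc i)))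
proposition3p4 n μ ν λ′ _ _ _ h (h₀₀ , boundary) =
  ⇔.trans (IC1⇔AllRhombi n h) (⇔.sym (ε-bounds⇔AllRhombi n μ h row0))
  where
    row0 : Row0 n μ h
    row0 zero _ = h₀₀
    row0 (suc k) 1+k≤n = proj₁ (boundary (suc k) (s≤s z≤n) 1+k≤n)
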